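{- Let $m$ and $n$ be positive integers with $n \geq 4$ even, let $0 \leq \ell \leq n-1$ be an integer of the same parity as $m$, and let $$G = \langle t,x,y \mid t^2,\ x^{n/2},\ y^m = x^{(\ell + m)/2},\ txt = x^{ -1},\ tyt = y^{ -1},\ xy = yx\rangle.$$ Then there exists a group automorphism $\varphi$ of $G$ with $\varphi(ty)=ty$, $\varphi(t)=tx$ and $\varphi(tx)=t$ if and only if $\ell \in \{0,n/2\}$. -}

module Defs where

open import Level using (0ℓ)
open import Data.Nat using (ℕ; zero; suc; _+_)
open import Data.Nat.DivMod using (_/_)
open import Data.Product using (Σ; _×_; _,_)
open import Algebra.Bundles using (Group)
open import Algebra.Morphism.Structures using (module GroupMorphisms)

module _ (G : Group 0ℓ 0ℓ) where
  open Group G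

  pow : Carrier → ℕ → Carrier
  pow g zero    = ε
  pow g (suc k) = g ∙ pow g k

  record Rels (n m ℓ : ℕ) (t x y : Carrier) : Set where
    field
      rel-t²   : t ∙ t ≈ ε
      rel-x    : pow x (n / 2) ≈ ε
      rel-y    : pow y m ≈ pow x ((ℓ + m) / 2)
      rel-txt  : (t ∙ x) ∙ t ≈ x ⁻¹
      rel-tyt  : (t ∙ y) ∙ t ≈ y ⁻¹
      rel-xy   : x ∙ y ≈ y ∙ x

IsHom : (G H : Group 0ℓ 0ℓ) → (Group.Carrier G → Group.Carrier H) → Set
IsHom G H = GroupMorphisms.IsGroupHomomorphism (Group.rawGroup G) (Group.rawGroup H)

IsIso : (G H : Group 0ℓ 0ℓ) → (Group.Carrier G → Group.Carrier H) → Set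
IsIso G H = GroupMorphisms.IsGroupIsomorphism (Group.rawGroup G) (Group.rawGroup H)

-- G, with distinguished elements t x y, is presented by the above
-- generators and relations: the relations hold in G, and G has the
-- universal property (every triple satisfying the relations in any group H
-- is the image of (t,x,y) under a unique homomorphism G → H).
record IsPresentation (n m ℓ : ℕ) (G : Group 0ℓ 0ℓ) (t x y : Group.Carrier G) : Set₁ where
  field
    rels      : Rels G n m ℓ t x y
    lift      : (H : Group 0ℓ 0ℓ) (t' x' y' : Group.Carrier H) → Rels H n m ℓ t' x' y' →
                Σ (Group.Carrier G → Group.Carrier H) λ f → IsHom G H f ×
                  (Group._≈_ H (f t) t' × Group._≈_ H (f x) x' × Group._≈_ H (f y) y')
    unique    : (H : Group 0ℓ 0ℓ) (f g : Group.Carrier G → Group.Carrier H) →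
                IsHom G H f → IsHom G H g →
                Group._≈_ H (f t) (g t) → Group._≈_ H (f x) (g x) → Group._≈_ H (f y) (g y) →
                (a : Group.Carrier G) → Group._≈_ H (f a) (g a)

{-# OPTIONS --safe #-}
-- An automorphism φ with φ t = tx, φ (tx) = t and φ (ty) = ty must send x ↦ x⁻¹ and y ↦ x⁻¹y.
-- By the universal property such a φ exists iff (tx, x⁻¹, x⁻¹y) satisfies the defining
-- relations, and then φ ∘ φ = id. Every relation but the one for y holds automatically, and
-- since (x⁻¹y)ᵐ = x⁻ᵐ xᶜ with c = (ℓ+m)/2, that one reads x²ᶜ = xᵐ, i.e. xˡ = 1. Finally x has
-- order exactly n/2: the dihedral group ℤ/(n/2·m) ⋊ ℤ/2 with t ↦ reflection, x ↦ rotation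
-- by m and y ↦ rotation by c satisfies the relations. So xˡ = 1 with 0 ≤ ℓ < n means
-- ℓ ∈ {0, n/2}.
module Submission where

open import Defs
open import Level using (0ℓ)
open import Algebra.Bundles using (Group; AbelianGroup)
open import Algebra.Morphism.Structures using (module GroupMorphisms)
import Algebra.Morphism.Construct.Composition as Composition
import Algebra.Morphism.Construct.Identity as Identity
import Algebra.Properties.AbelianGroup as AbelianGroupProperties
import Algebra.Properties.Group as GroupProperties
import Algebra.Properties.Monoid as MonoidProperties
import Algebra.Definitions.RawMonoid as RawMonoidDefinitions
open import Data.Bool using (Bool; true; false; _xor_)
open import Data.Bool.Properties using (xor-assoc; xor-identityʳ)
open import Data.Empty using (⊥-elim)
open import Data.Integer as ℤ using (ℤ; +_; 0ℤ)
import Data.Integer.Properties as ℤ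
open import Data.Integer.Divisibility.Signed as ℤ∣
  using (∣m⇒∣-m; ∣m∣n⇒∣m+n; ∣⇒∣ᵤ)
open import Data.Integer.Tactic.RingSolver using (solve-∀)
open import Data.Nat using (ℕ; zero; suc; _+_; _*_; _≤_; _<_; NonZero; >-nonZero)
import Data.Nat.Properties as ℕ
open import Data.Nat.DivMod using (_/_; m*[n/m]≡n)
open import Data.Nat.Divisibility using (_∣_; divides; *-cancelʳ-∣)
open import Data.Product using (Σ; _×_; _,_; proj₂)
open import Data.Product.Relation.Binary.Pointwise.NonDependent using (Pointwise; ×-isEquivalence)
open import Data.Sum using (_⊎_; inj₁; inj₂)
open import Function using (_∘_)
open import Function.Bundles using (_⇔_; mk⇔; Equivalence)
open import Relation.Binary.PropositionalEquality as ≡ using (_≡_)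

module GroupPowers (G : Group 0ℓ 0ℓ) where
  open Group G
  open GroupProperties G
  open import Relation.Binary.Reasoning.Setoid setoid

  pow-cong : ∀ {g h} k → g ≈ h → pow G g k ≈ pow G h k
  pow-cong zero    g≈h = refl
  pow-cong (suc k) g≈h = ∙-cong g≈h (pow-cong k g≈h)

  pow-+ : ∀ g i j → pow G g (i + j) ≈ pow G g i ∙ pow G g j
  pow-+ g zero    j = sym (identityˡ _)
  pow-+ g (suc i) j = trans (∙-congˡ (pow-+ g i j)) (sym (assoc _ _ _))

  pow-comm : ∀ {g h} k → g ∙ h ≈ h ∙ g → pow G g k ∙ h ≈ h ∙ pow G g k
  pow-comm {g} {h} zero    gh≈hg = trans (identityˡ h) (sym (identityʳ h))
  pow-comm {g} {h} (suc k) gh≈hg = begin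
    (g ∙ pow G g k) ∙ h  ≈⟨ assoc _ _ _ ⟩
    g ∙ (pow G g k ∙ h)  ≈⟨ ∙-congˡ (pow-comm k gh≈hg) ⟩
    g ∙ (h ∙ pow G g k)  ≈⟨ assoc _ _ _ ⟨
    (g ∙ h) ∙ pow G g k  ≈⟨ ∙-congʳ gh≈hg ⟩
    (h ∙ g) ∙ pow G g k  ≈⟨ assoc _ _ _ ⟩
    h ∙ (g ∙ pow G g k)  ∎

  pow-distrib-∙ : ∀ {g h} k → g ∙ h ≈ h ∙ g → pow G (g ∙ h) k ≈ pow G g k ∙ pow G h k
  pow-distrib-∙ zero    gh≈hg = sym (identityˡ ε)
  pow-distrib-∙ {g} {h} (suc k) gh≈hg = begin
    (g ∙ h) ∙ pow G (g ∙ h) k          ≈⟨ ∙-congˡ (pow-distrib-∙ k gh≈hg) ⟩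
    (g ∙ h) ∙ (pow G g k ∙ pow G h k)  ≈⟨ assoc _ _ _ ⟩
    g ∙ (h ∙ (pow G g k ∙ pow G h k))  ≈⟨ ∙-congˡ (assoc _ _ _) ⟨
    g ∙ ((h ∙ pow G g k) ∙ pow G h k)  ≈⟨ ∙-congˡ (∙-congʳ (pow-comm k gh≈hg)) ⟨
    g ∙ ((pow G g k ∙ h) ∙ pow G h k)  ≈⟨ ∙-congˡ (assoc _ _ _) ⟩
    g ∙ (pow G g k ∙ (h ∙ pow G h k))  ≈⟨ assoc _ _ _ ⟨
    (g ∙ pow G g k) ∙ (h ∙ pow G h k)  ∎

  pow-⁻¹ : ∀ g k → pow G (g ⁻¹) k ≈ pow G g k ⁻¹
  pow-⁻¹ g zero    = sym ε⁻¹≈ε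
  pow-⁻¹ g (suc k) = begin
    g ⁻¹ ∙ pow G (g ⁻¹) k  ≈⟨ ∙-congˡ (pow-⁻¹ g k) ⟩
    g ⁻¹ ∙ pow G g k ⁻¹    ≈⟨ ⁻¹-anti-homo-∙ _ _ ⟨
    (pow G g k ∙ g) ⁻¹     ≈⟨ ⁻¹-cong (pow-comm k refl) ⟩
    (g ∙ pow G g k) ⁻¹     ∎


module GroupInverses (G : Group 0ℓ 0ℓ) where
  open Group G
  open GroupProperties G
  open import Relation.Binary.Reasoning.Setoid setoid

  ⁻¹-comm : ∀ {g h} → g ∙ h ≈ h ∙ g → g ⁻¹ ∙ h ≈ h ∙ g ⁻¹
  ⁻¹-comm {g} {h} gh≈hg = begin
    g ⁻¹ ∙ h                  ≈⟨ identityʳ _ ⟨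
    (g ⁻¹ ∙ h) ∙ ε            ≈⟨ ∙-congˡ (inverseʳ g) ⟨
    (g ⁻¹ ∙ h) ∙ (g ∙ g ⁻¹)   ≈⟨ assoc _ _ _ ⟩
    g ⁻¹ ∙ (h ∙ (g ∙ g ⁻¹))   ≈⟨ ∙-congˡ (assoc _ _ _) ⟨
    g ⁻¹ ∙ ((h ∙ g) ∙ g ⁻¹)   ≈⟨ ∙-congˡ (∙-congʳ gh≈hg) ⟨
    g ⁻¹ ∙ ((g ∙ h) ∙ g ⁻¹)   ≈⟨ ∙-congˡ (assoc _ _ _) ⟩
    g ⁻¹ ∙ (g ∙ (h ∙ g ⁻¹))   ≈⟨ assoc _ _ _ ⟨
    (g ⁻¹ ∙ g) ∙ (h ∙ g ⁻¹)   ≈⟨ ∙-congʳ (inverseˡ g) ⟩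
    ε ∙ (h ∙ g ⁻¹)            ≈⟨ identityˡ _ ⟩
    h ∙ g ⁻¹                  ∎

  ⁻¹∙≈⁻¹⇔∙≈ : ∀ a b → (a ⁻¹ ∙ b ≈ b ⁻¹) ⇔ (b ∙ b ≈ a)
  ⁻¹∙≈⁻¹⇔∙≈ a b = mk⇔ to from
    where
    to : a ⁻¹ ∙ b ≈ b ⁻¹ → b ∙ b ≈ a
    to a⁻¹b≈b⁻¹ = trans (inverseʳ-unique (a ⁻¹) (b ∙ b) (begin
      a ⁻¹ ∙ (b ∙ b)  ≈⟨ assoc _ _ _ ⟨
      (a ⁻¹ ∙ b) ∙ b  ≈⟨ ∙-congʳ a⁻¹b≈b⁻¹ ⟩
      b ⁻¹ ∙ b        ≈⟨ inverseˡ b ⟩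
      ε               ∎)) (⁻¹-involutive a)
    from : b ∙ b ≈ a → a ⁻¹ ∙ b ≈ b ⁻¹
    from bb≈a = begin
      a ⁻¹ ∙ b              ≈⟨ ∙-congʳ (⁻¹-cong bb≈a) ⟨
      (b ∙ b) ⁻¹ ∙ b        ≈⟨ ∙-congʳ (⁻¹-anti-homo-∙ b b) ⟩
      (b ⁻¹ ∙ b ⁻¹) ∙ b     ≈⟨ assoc _ _ _ ⟩
      b ⁻¹ ∙ (b ⁻¹ ∙ b)     ≈⟨ ∙-congˡ (inverseˡ b) ⟩
      b ⁻¹ ∙ ε              ≈⟨ identityʳ _ ⟩
      b ⁻¹                  ∎

module _ {G H : Group 0ℓ 0ℓ} {f : Group.Carrier G → Group.Carrier H} (hom : IsHom G H f) where
  open Group H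
  open GroupMorphisms.IsGroupHomomorphism hom

  pow-homo : ∀ g k → f (pow G g k) ≈ pow H (f g) k
  pow-homo g zero    = ε-homo
  pow-homo g (suc k) = trans (homo _ _) (∙-congˡ (pow-homo g k))

module _ {G : Group 0ℓ 0ℓ} {f : Group.Carrier G → Group.Carrier G} (hom : IsHom G G f) where
  open Group G
  open GroupMorphisms.IsGroupHomomorphism hom

  involutive-hom⇒iso : (∀ a → f (f a) ≈ a) → IsIso G G f
  involutive-hom⇒iso ff≈id = record
    { isGroupMonomorphism = record
      { isGroupHomomorphism = hom
      ; injective = λ {a} {b} fa≈fb → trans (sym (ff≈id a)) (trans (⟦⟧-cong fa≈fb) (ff≈id b))
      }
    ; surjective = λ b → f b , λ a≈fb → trans (⟦⟧-cong a≈fb) (ff≈id b)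
    }

module Dihedral (A : AbelianGroup 0ℓ 0ℓ) where
  open AbelianGroup A
    renaming ( Carrier to Ȧ; _≈_ to _≈ᴬ_; _∙_ to _+ᴬ_; ε to 0ᴬ; _⁻¹ to -ᴬ_
             ; ∙-cong to +-cong; ∙-congˡ to +-congˡ; assoc to +-assoc
             ; identityˡ to +-identityˡ; identityʳ to +-identityʳ
             ; inverseˡ to -‿inverseˡ; inverseʳ to -‿inverseʳ; ⁻¹-cong to -‿cong; comm to +-comm)
  open AbelianGroupProperties A using (⁻¹-∙-comm; xyx⁻¹≈y)
  open GroupProperties group using (ε⁻¹≈ε; ⁻¹-involutive)
  open import Relation.Binary.Reasoning.Setoid setoid

  act : Bool → Ȧ → Ȧ
  act false a = a
  act true  a = -ᴬ a

  act-cong : ∀ s {a b} → a ≈ᴬ b → act s a ≈ᴬ act s b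
  act-cong false a≈b = a≈b
  act-cong true  a≈b = -‿cong a≈b

  act-0ᴬ : ∀ s → act s 0ᴬ ≈ᴬ 0ᴬ
  act-0ᴬ false = refl
  act-0ᴬ true  = ε⁻¹≈ε

  act-+ : ∀ s a b → act s (a +ᴬ b) ≈ᴬ act s a +ᴬ act s b
  act-+ false a b = refl
  act-+ true  a b = sym (⁻¹-∙-comm a b)

  act-xor : ∀ s s′ a → act (s xor s′) a ≈ᴬ act s (act s′ a)
  act-xor false s′    a = refl
  act-xor true  false a = refl
  act-xor true  true  a = sym (⁻¹-involutive a)

  infix  4 _≈_
  infixl 7 _∙_
  infix  8 _⁻¹

  -- (false , a) is the rotation by a, and (true , a) = (false , a) ∙ (true , 0ᴬ) a reflection.
  Element : Set
  Element = Bool × Ȧ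

  _≈_ : Element → Element → Set
  _≈_ = Pointwise _≡_ _≈ᴬ_

  _∙_ : Element → Element → Element
  (s , a) ∙ (s′ , b) = s xor s′ , a +ᴬ act s b

  ε : Element
  ε = false , 0ᴬ

  _⁻¹ : Element → Element
  (false , a) ⁻¹ = false , -ᴬ a
  (true  , a) ⁻¹ = true  , a

  ∙-cong : ∀ {u u′ v v′} → u ≈ u′ → v ≈ v′ → u ∙ v ≈ u′ ∙ v′
  ∙-cong {s , _} (≡.refl , a≈a′) (≡.refl , b≈b′) = ≡.refl , +-cong a≈a′ (act-cong s b≈b′)

  assoc : ∀ u v w → (u ∙ v) ∙ w ≈ u ∙ (v ∙ w)
  assoc (s , a) (s′ , b) (s″ , c) = xor-assoc s s′ s″ , (begin
    (a +ᴬ act s b) +ᴬ act (s xor s′) c      ≈⟨ +-congˡ (act-xor s s′ c) ⟩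
    (a +ᴬ act s b) +ᴬ act s (act s′ c)      ≈⟨ +-assoc _ _ _ ⟩
    a +ᴬ (act s b +ᴬ act s (act s′ c))      ≈⟨ +-congˡ (act-+ s b (act s′ c)) ⟨
    a +ᴬ act s (b +ᴬ act s′ c)              ∎)

  identityˡ : ∀ u → ε ∙ u ≈ u
  identityˡ (s , a) = ≡.refl , +-identityˡ a

  identityʳ : ∀ u → u ∙ ε ≈ u
  identityʳ (s , a) = xor-identityʳ s , trans (+-congˡ (act-0ᴬ s)) (+-identityʳ a)

  inverseˡ : ∀ u → u ⁻¹ ∙ u ≈ ε
  inverseˡ (false , a) = ≡.refl , -‿inverseˡ a
  inverseˡ (true  , a) = ≡.refl , -‿inverseʳ a

  inverseʳ : ∀ u → u ∙ u ⁻¹ ≈ ε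
  inverseʳ (false , a) = ≡.refl , -‿inverseʳ a
  inverseʳ (true  , a) = ≡.refl , -‿inverseʳ a

  ⁻¹-cong : ∀ {u v} → u ≈ v → u ⁻¹ ≈ v ⁻¹
  ⁻¹-cong {false , _} (≡.refl , a≈b) = ≡.refl , -‿cong a≈b
  ⁻¹-cong {true  , _} (≡.refl , a≈b) = ≡.refl , a≈b

  dihedral : Group 0ℓ 0ℓ
  dihedral = record
    { Carrier = Element ; _≈_ = _≈_ ; _∙_ = _∙_ ; ε = ε ; _⁻¹ = _⁻¹
    ; isGroup = record
      { isMonoid = record
        { isSemigroup = record
          { isMagma = record
            { isEquivalence = ×-isEquivalence ≡.isEquivalence isEquivalence
            ; ∙-cong = ∙-cong
            }
          ; assoc = assoc
          }
        ; identity = identityˡ , identityʳ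
        }
      ; inverse = inverseˡ , inverseʳ
      ; ⁻¹-cong = ⁻¹-cong
      }
    }

  open RawMonoidDefinitions rawMonoid using () renaming (_×_ to _×ᴬ_)

  rotation-pow : ∀ a j → pow dihedral (false , a) j ≡ (false , j ×ᴬ a)
  rotation-pow a zero    = ≡.refl
  rotation-pow a (suc j) = ≡.cong ((false , a) ∙_) (rotation-pow a j)

  rotations-comm : ∀ a b → (false , a) ∙ (false , b) ≈ (false , b) ∙ (false , a)
  rotations-comm a b = ≡.refl , +-comm a b

  reflection-square : ∀ a → (true , a) ∙ (true , a) ≈ ε
  reflection-square a = ≡.refl , -‿inverseʳ a

  reflection-conj : ∀ b a → ((true , b) ∙ (false , a)) ∙ (true , b) ≈ (false , a) ⁻¹
  reflection-conj b a = ≡.refl , xyx⁻¹≈y b (-ᴬ a)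

module IntegersModulo (N : ℕ) where

  infix 4 _≡_[mod]
  record _≡_[mod] (a b : ℤ) : Set where
    constructor congruent
    field N∣a-b : + N ℤ∣.∣ a ℤ.- b

  ≡⇒≡[mod] : ∀ {a b} → a ≡ b → a ≡ b [mod]
  ≡⇒≡[mod] {a} ≡.refl = congruent (ℤ∣.divides 0ℤ (ℤ.+-inverseʳ a))

  ≡[mod]-sym : ∀ {a b} → a ≡ b [mod] → b ≡ a [mod]
  ≡[mod]-sym {a} {b} (congruent N∣a-b) = congruent (≡.subst (+ N ℤ∣.∣_) (neg-minus a b) (∣m⇒∣-m N∣a-b))
    where neg-minus : ∀ a b → ℤ.- (a ℤ.- b) ≡ b ℤ.- a
          neg-minus = solve-∀

  ≡[mod]-trans : ∀ {a b c} → a ≡ b [mod] → b ≡ c [mod] → a ≡ c [mod]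
  ≡[mod]-trans {a} {b} {c} (congruent N∣a-b) (congruent N∣b-c) =
    congruent (≡.subst (+ N ℤ∣.∣_) (ℤ.+-minus-telescope a b c) (∣m∣n⇒∣m+n N∣a-b N∣b-c))

  +-cong : ∀ {a a′ b b′} → a ≡ a′ [mod] → b ≡ b′ [mod] → a ℤ.+ b ≡ a′ ℤ.+ b′ [mod]
  +-cong {a} {a′} {b} {b′} (congruent N∣a-a′) (congruent N∣b-b′) =
    congruent (≡.subst (+ N ℤ∣.∣_) (interchange a a′ b b′) (∣m∣n⇒∣m+n N∣a-a′ N∣b-b′))
    where interchange : ∀ a a′ b b′ → (a ℤ.- a′) ℤ.+ (b ℤ.- b′) ≡ (a ℤ.+ b) ℤ.- (a′ ℤ.+ b′)
          interchange = solve-∀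

  neg-cong : ∀ {a b} → a ≡ b [mod] → ℤ.- a ≡ ℤ.- b [mod]
  neg-cong {a} {b} (congruent N∣a-b) = congruent (≡.subst (+ N ℤ∣.∣_) (neg-minus a b) (∣m⇒∣-m N∣a-b))
    where neg-minus : ∀ a b → ℤ.- (a ℤ.- b) ≡ ℤ.- a ℤ.- ℤ.- b
          neg-minus = solve-∀

  ℤ/N : AbelianGroup 0ℓ 0ℓ
  ℤ/N = record
    { Carrier = ℤ ; _≈_ = _≡_[mod] ; _∙_ = ℤ._+_ ; ε = 0ℤ ; _⁻¹ = ℤ.-_
    ; isAbelianGroup = record
      { isGroup = record
        { isMonoid = record
          { isSemigroup = record
            { isMagma = record
              { isEquivalence = record { refl = ≡⇒≡[mod] ≡.refl ; sym = ≡[mod]-sym ; trans = ≡[mod]-trans }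
              ; ∙-cong = +-cong
              }
            ; assoc = λ a b c → ≡⇒≡[mod] (ℤ.+-assoc a b c)
            }
          ; identity = ≡⇒≡[mod] ∘ ℤ.+-identityˡ , ≡⇒≡[mod] ∘ ℤ.+-identityʳ
          }
        ; inverse = ≡⇒≡[mod] ∘ ℤ.+-inverseˡ , ≡⇒≡[mod] ∘ ℤ.+-inverseʳ
        ; ⁻¹-cong = neg-cong
        }
      ; comm = λ a b → ≡⇒≡[mod] (ℤ.+-comm a b)
      }
    }

  open RawMonoidDefinitions (AbelianGroup.rawMonoid ℤ/N) public using () renaming (_×_ to _×ᴺ_)

  ×ᴺ-pos : ∀ j i → j ×ᴺ + i ≡ + (j * i)
  ×ᴺ-pos zero    i = ≡.refl
  ×ᴺ-pos (suc j) i = ≡.cong (ℤ._+_ (+ i)) (×ᴺ-pos j i)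

  N≡0[mod] : + N ≡ 0ℤ [mod]
  N≡0[mod] = congruent (ℤ∣.divides (+ 1) (≡.trans (ℤ.+-identityʳ (+ N)) (≡.sym (ℤ.*-identityˡ (+ N)))))

  ≡0[mod]⇒∣ : ∀ {i} → + i ≡ 0ℤ [mod] → N ∣ i
  ≡0[mod]⇒∣ {i} (congruent N∣i-0) = ∣⇒∣ᵤ (≡.subst (+ N ℤ∣.∣_) (ℤ.+-identityʳ (+ i)) N∣i-0)

m≡m/2+m/2 : ∀ {m} → 2 ∣ m → m ≡ m / 2 + m / 2
m≡m/2+m/2 {m} 2∣m = ≡.trans (≡.sym (m*[n/m]≡n 2∣m)) (≡.cong (_+_ (m / 2)) (ℕ.+-identityʳ (m / 2)))

m∣n∧n<m+m⇒n≡0⊎n≡m : ∀ {m n} → m ∣ n → n < m + m → n ≡ 0 ⊎ n ≡ m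
m∣n∧n<m+m⇒n≡0⊎n≡m         (divides zero          n≡0)   _ = inj₁ n≡0
m∣n∧n<m+m⇒n≡0⊎n≡m {m}     (divides (suc zero)    n≡m+0) _ = inj₂ (≡.trans n≡m+0 (ℕ.+-identityʳ m))
m∣n∧n<m+m⇒n≡0⊎n≡m {m} {n} (divides (suc (suc q)) n≡m+[m+qm]) n<m+m =
  ⊥-elim (ℕ.<⇒≱ n<m+m (≡.subst (m + m ≤_) (≡.sym n≡m+[m+qm]) (ℕ.+-monoʳ-≤ m (ℕ.m≤m+n m (q * m)))))

module DihedralModel (n m ℓ : ℕ) where
  open IntegersModulo (n / 2 * m) public
  open Dihedral ℤ/N public

  model-rels : Rels dihedral n m ℓ (true , 0ℤ) (false , + m) (false , + ((ℓ + m) / 2))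
  model-rels = record
    { rel-t²  = reflection-square 0ℤ
    ; rel-x   = ≡.subst (_≈ ε) (≡.sym (rotation-pow (+ m) (n / 2)))
                  (≡.refl , ≡[mod]-trans (≡⇒≡[mod] (×ᴺ-pos (n / 2) m)) N≡0[mod])
    ; rel-y   = ≡.subst₂ _≈_ (≡.sym (rotation-pow (+ c) m)) (≡.sym (rotation-pow (+ m) c))
                  (≡.refl , ≡⇒≡[mod] (≡.trans (×ᴺ-pos m c)
                                       (≡.trans (≡.cong +_ (ℕ.*-comm m c)) (≡.sym (×ᴺ-pos c m)))))
    ; rel-txt = reflection-conj 0ℤ (+ m)
    ; rel-tyt = reflection-conj 0ℤ (+ c)
    ; rel-xy  = rotations-comm (+ m) (+ c)
    }
    where c = (ℓ + m) / 2

module _ {n m ℓ : ℕ} {G : Group 0ℓ 0ℓ} {t x y : Group.Carrier G} (P : IsPresentation n m ℓ G t x y) where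
  open Group G
  open IsPresentation P
  private module D = DihedralModel n m ℓ

  pow-x≈ε⇒n/2∣ : .{{_ : NonZero m}} → ∀ j → pow G x j ≈ ε → n / 2 ∣ j
  pow-x≈ε⇒n/2∣ j x^j≈ε with lift D.dihedral (true , 0ℤ) (false , + m) (false , + ((ℓ + m) / 2)) D.model-rels
  ... | f , f-hom , _ , fx≈x′ , _ =
    *-cancelʳ-∣ m (D.≡0[mod]⇒∣ (≡.subst (D._≡ 0ℤ [mod]) (D.×ᴺ-pos j m) (proj₂ x′^j≈ε)))
    where
    open GroupMorphisms.IsGroupHomomorphism f-hom using (⟦⟧-cong; ε-homo)
    open import Relation.Binary.Reasoning.Setoid (Group.setoid D.dihedral)
    x′^j≈ε : (false , j D.×ᴺ + m) D.≈ D.ε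
    x′^j≈ε = ≡.subst (D._≈ D.ε) (D.rotation-pow (+ m) j) (begin
      pow D.dihedral (false , + m) j  ≈⟨ GroupPowers.pow-cong D.dihedral j fx≈x′ ⟨
      pow D.dihedral (f x) j          ≈⟨ pow-homo f-hom x j ⟨
      f (pow G x j)                   ≈⟨ ⟦⟧-cong x^j≈ε ⟩
      f ε                             ≈⟨ ε-homo ⟩
      D.ε                             ∎)

module Relations {n m ℓ : ℕ} {G : Group 0ℓ 0ℓ} {t x y : Group.Carrier G}
                 (rels : Rels G n m ℓ t x y) (2∣ℓ+m : 2 ∣ ℓ + m) where
  open Group G
  open Rels rels
  open GroupProperties G using (identityˡ-unique; ε⁻¹≈ε; ⁻¹-involutive; ⁻¹-anti-homo-∙)
  open MonoidProperties monoid using (elimˡ; cancelˡ; cancelʳ)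
  open GroupPowers G
  open GroupInverses G
  open import Relation.Binary.Reasoning.Setoid setoid

  private
    c = (ℓ + m) / 2

  t∙[t∙a]≈a : ∀ a → t ∙ (t ∙ a) ≈ a
  t∙[t∙a]≈a = cancelˡ rel-t²

  tx∙x⁻¹≈t : (t ∙ x) ∙ x ⁻¹ ≈ t
  tx∙x⁻¹≈t = cancelʳ (inverseʳ x) t

  tx∙x⁻¹y≈ty : (t ∙ x) ∙ (x ⁻¹ ∙ y) ≈ t ∙ y
  tx∙x⁻¹y≈ty = trans (sym (assoc _ _ _)) (∙-congʳ tx∙x⁻¹≈t)

  pow-x⁻¹y : pow G (x ⁻¹ ∙ y) m ≈ pow G x m ⁻¹ ∙ pow G x c
  pow-x⁻¹y = trans (pow-distrib-∙ m (⁻¹-comm rel-xy)) (∙-cong (pow-⁻¹ x m) rel-y)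

  x^c∙x^c≈x^ℓ∙x^m : pow G x c ∙ pow G x c ≈ pow G x ℓ ∙ pow G x m
  x^c∙x^c≈x^ℓ∙x^m = begin
    pow G x c ∙ pow G x c  ≈⟨ pow-+ x c c ⟨
    pow G x (c + c)        ≡⟨ ≡.cong (pow G x) (m≡m/2+m/2 2∣ℓ+m) ⟨
    pow G x (ℓ + m)        ≈⟨ pow-+ x ℓ m ⟩
    pow G x ℓ ∙ pow G x m  ∎

  twisted-rel-y : (pow G (x ⁻¹ ∙ y) m ≈ pow G (x ⁻¹) c) ⇔ (pow G x ℓ ≈ ε)
  twisted-rel-y = mk⇔ to from
    where
    to : pow G (x ⁻¹ ∙ y) m ≈ pow G (x ⁻¹) c → pow G x ℓ ≈ ε
    to e = identityˡ-unique _ _ (trans (sym x^c∙x^c≈x^ℓ∙x^m)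
             (Equivalence.to (⁻¹∙≈⁻¹⇔∙≈ _ _) (trans (sym pow-x⁻¹y) (trans e (pow-⁻¹ x c)))))
    from : pow G x ℓ ≈ ε → pow G (x ⁻¹ ∙ y) m ≈ pow G (x ⁻¹) c
    from x^ℓ≈ε = trans pow-x⁻¹y (trans
      (Equivalence.from (⁻¹∙≈⁻¹⇔∙≈ _ _) (trans x^c∙x^c≈x^ℓ∙x^m (elimˡ x^ℓ≈ε _)))
      (sym (pow-⁻¹ x c)))

  twisted-rels : pow G x ℓ ≈ ε → Rels G n m ℓ (t ∙ x) (x ⁻¹) (x ⁻¹ ∙ y)
  twisted-rels x^ℓ≈ε = record
    { rel-t²  = trans (sym (assoc _ _ _)) (trans (∙-congʳ rel-txt) (inverseˡ x))
    ; rel-x   = trans (pow-⁻¹ x (n / 2)) (trans (⁻¹-cong rel-x) ε⁻¹≈ε)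
    ; rel-y   = Equivalence.from twisted-rel-y x^ℓ≈ε
    ; rel-txt = trans (∙-congʳ tx∙x⁻¹≈t) (trans (t∙[t∙a]≈a x) (sym (⁻¹-involutive x)))
    ; rel-tyt = begin
        ((t ∙ x) ∙ (x ⁻¹ ∙ y)) ∙ (t ∙ x)  ≈⟨ ∙-congʳ tx∙x⁻¹y≈ty ⟩
        (t ∙ y) ∙ (t ∙ x)                 ≈⟨ assoc _ _ _ ⟨
        ((t ∙ y) ∙ t) ∙ x                 ≈⟨ ∙-cong rel-tyt (sym (⁻¹-involutive x)) ⟩
        y ⁻¹ ∙ x ⁻¹ ⁻¹                    ≈⟨ ⁻¹-anti-homo-∙ (x ⁻¹) y ⟨
        (x ⁻¹ ∙ y) ⁻¹                     ∎
    ; rel-xy  = trans (∙-congˡ (⁻¹-comm rel-xy)) (sym (assoc _ _ _))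
    }

  module _ {φ : Carrier → Carrier} (φ-hom : IsHom G G φ)
           (φt≈tx : φ t ≈ t ∙ x) (φtx≈t : φ (t ∙ x) ≈ t) (φty≈ty : φ (t ∙ y) ≈ t ∙ y) where
    open GroupMorphisms.IsGroupHomomorphism φ-hom using (⟦⟧-cong; homo)

    φx≈x⁻¹ : φ x ≈ x ⁻¹
    φx≈x⁻¹ = begin
      φ x                ≈⟨ ⟦⟧-cong (t∙[t∙a]≈a x) ⟨
      φ (t ∙ (t ∙ x))    ≈⟨ homo t (t ∙ x) ⟩
      φ t ∙ φ (t ∙ x)    ≈⟨ ∙-cong φt≈tx φtx≈t ⟩
      (t ∙ x) ∙ t        ≈⟨ rel-txt ⟩
      x ⁻¹               ∎

    φy≈x⁻¹y : φ y ≈ x ⁻¹ ∙ y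
    φy≈x⁻¹y = begin
      φ y                ≈⟨ ⟦⟧-cong (t∙[t∙a]≈a y) ⟨
      φ (t ∙ (t ∙ y))    ≈⟨ homo t (t ∙ y) ⟩
      φ t ∙ φ (t ∙ y)    ≈⟨ ∙-cong φt≈tx φty≈ty ⟩
      (t ∙ x) ∙ (t ∙ y)  ≈⟨ assoc _ _ _ ⟨
      ((t ∙ x) ∙ t) ∙ y  ≈⟨ ∙-congʳ rel-txt ⟩
      x ⁻¹ ∙ y           ∎

    swap⇒pow-x-ℓ≈ε : pow G x ℓ ≈ ε
    swap⇒pow-x-ℓ≈ε = Equivalence.to twisted-rel-y (begin
      pow G (x ⁻¹ ∙ y) m  ≈⟨ pow-cong m φy≈x⁻¹y ⟨
      pow G (φ y) m       ≈⟨ pow-homo φ-hom y m ⟨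
      φ (pow G y m)       ≈⟨ ⟦⟧-cong rel-y ⟩
      φ (pow G x c)       ≈⟨ pow-homo φ-hom x c ⟩
      pow G (φ x) c       ≈⟨ pow-cong c φx≈x⁻¹ ⟩
      pow G (x ⁻¹) c      ∎)

module _ {n m ℓ : ℕ} {G : Group 0ℓ 0ℓ} {t x y : Group.Carrier G}
         (P : IsPresentation n m ℓ G t x y) (2∣ℓ+m : 2 ∣ ℓ + m) where
  open Group G
  open IsPresentation P
  open Rels rels using (rel-x)
  open Relations rels 2∣ℓ+m
  open GroupProperties G using (⁻¹-involutive)
  open MonoidProperties monoid using (cancelˡ)

  pow-x-ℓ≈ε⇒swap : pow G x ℓ ≈ ε →
    Σ (Carrier → Carrier) λ φ → IsIso G G φ × (φ (t ∙ y) ≈ t ∙ y × φ t ≈ t ∙ x × φ (t ∙ x) ≈ t)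
  pow-x-ℓ≈ε⇒swap x^ℓ≈ε with lift G (t ∙ x) (x ⁻¹) (x ⁻¹ ∙ y) (twisted-rels x^ℓ≈ε)
  ... | φ , φ-hom , φt≈tx , φx≈x⁻¹ , φy≈x⁻¹y =
    φ , involutive-hom⇒iso {G = G} φ-hom φφ≈id , φty≈ty , φt≈tx , φtx≈t
    where
    open GroupMorphisms.IsGroupHomomorphism φ-hom using (⟦⟧-cong; homo; ⁻¹-homo)
    φty≈ty : φ (t ∙ y) ≈ t ∙ y
    φty≈ty = trans (homo t y) (trans (∙-cong φt≈tx φy≈x⁻¹y) tx∙x⁻¹y≈ty)
    φtx≈t : φ (t ∙ x) ≈ t
    φtx≈t = trans (homo t x) (trans (∙-cong φt≈tx φx≈x⁻¹) tx∙x⁻¹≈t)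
    φx⁻¹≈x : φ (x ⁻¹) ≈ x
    φx⁻¹≈x = trans (⁻¹-homo x) (trans (⁻¹-cong φx≈x⁻¹) (⁻¹-involutive x))
    φφ≈id : ∀ a → φ (φ a) ≈ a
    φφ≈id = unique G (φ ∘ φ) (λ a → a)
      (Composition.isGroupHomomorphism trans φ-hom φ-hom) (Identity.isGroupHomomorphism rawGroup refl)
      (trans (⟦⟧-cong φt≈tx) φtx≈t)
      (trans (⟦⟧-cong φx≈x⁻¹) φx⁻¹≈x)
      (trans (⟦⟧-cong φy≈x⁻¹y) (trans (homo (x ⁻¹) y) (trans (∙-cong φx⁻¹≈x φy≈x⁻¹y) (cancelˡ (inverseʳ x) y))))

  ℓ≡0⊎ℓ≡n/2⇒pow-x-ℓ≈ε : ℓ ≡ 0 ⊎ ℓ ≡ n / 2 → pow G x ℓ ≈ ε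
  ℓ≡0⊎ℓ≡n/2⇒pow-x-ℓ≈ε (inj₁ ≡.refl) = refl
  ℓ≡0⊎ℓ≡n/2⇒pow-x-ℓ≈ε (inj₂ ≡.refl) = rel-x

lemma4p3 : (m n ℓ : ℕ) → 1 ≤ m → 4 ≤ n → 2 ∣ n → ℓ < n → 2 ∣ (ℓ + m) →
             (G : Group 0ℓ 0ℓ) (t x y : Group.Carrier G) → IsPresentation n m ℓ G t x y →
             (Σ (Group.Carrier G → Group.Carrier G) (λ φ → IsIso G G φ ×
                (Group._≈_ G (φ (Group._∙_ G t y)) (Group._∙_ G t y) ×
                 Group._≈_ G (φ t) (Group._∙_ G t x) ×
                 Group._≈_ G (φ (Group._∙_ G t x)) t))
             ⇔ (ℓ ≡ 0 ⊎ ℓ ≡ n / 2))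
lemma4p3 m n ℓ 1≤m _ 2∣n ℓ<n 2∣ℓ+m G t x y P = mk⇔
  (λ (φ , φ-iso , φty≈ty , φt≈tx , φtx≈t) →
    m∣n∧n<m+m⇒n≡0⊎n≡m
      (pow-x≈ε⇒n/2∣ P {{>-nonZero 1≤m}} ℓ
        (swap⇒pow-x-ℓ≈ε (isGroupHomomorphism φ-iso) φt≈tx φtx≈t φty≈ty))
      (≡.subst (ℓ <_) (m≡m/2+m/2 2∣n) ℓ<n))
  (pow-x-ℓ≈ε⇒swap P 2∣ℓ+m ∘ ℓ≡0⊎ℓ≡n/2⇒pow-x-ℓ≈ε P 2∣ℓ+m)
  where
  open IsPresentation P using (rels)
  open Relations rels 2∣ℓ+m using (swap⇒pow-x-ℓ≈ε)
  open GroupMorphisms.IsGroupIsomorphism using (isGroupHomomorphism)
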